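{- Let $\xi$ be an $\mathrm{ab}3$ position such that $\xi^{LR}=\xi^{RL}=0$, i.e. the Right option of the Left option of $\xi$ is $0$ and the Left option of the Right option of $\xi$ is $0$. Then $\xi\equiv 0\pmod{\mathrm{cl}(\mathrm{ab}3)}$.
   Context: A position $\xi=\{\xi^L \mid \xi^R\}$ is given recursively by finite sets of Left and Right options; $0=\{\cdot\mid\cdot\}$. A position is all-small if Left can move in it iff Right can, and every option is all-small. A position is $\mathrm{ab}n$ if it is all-small, binary (from every position in its game tree each player has at most one option), and every alternating path in its game tree (a sequence of moves from the root alternating between Left and Right moves) has length at most $n$. Disjunctive sum: $\alpha+\beta=\{\alpha^L+\beta,\alpha+\beta^L \mid \alpha^R+\beta,\alpha+\beta^R\}$. Under misère play a player unable to move on their turn wins; $o^-$ denotes misère outcome ($\mathcal{L}$, $\mathcal{R}$, $\mathcal{N}$ next player wins, $\mathcal{P}$ next player loses). $\mathrm{cl}(\mathrm{ab}3)$ is the smallest set containing all $\mathrm{ab}3$ positions that is closed under disjunctive sum and taking options. For a closed set $\Gamma$, $\alpha\equiv\beta\pmod\Gamma$ means $o^-(\alpha+\gamma)=o^-(\beta+\gamma)$ for all $\gamma\in\Gamma$. -}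

module Defs where

open import Data.Nat using (ℕ; zero; suc; _≤_)
open import Data.Bool using (Bool; true; false; _∧_; not)
open import Data.List using (List; []; _∷_; _++_; length)
open import Data.List.Relation.Unary.All using (All)
open import Data.List.Membership.Propositional using (_∈_)
open import Data.Product using (_×_)
open import Relation.Binary.PropositionalEquality using (_≡_)
open import Function.Bundles using (_⇔_)

data Game : Set where
  node : List Game → List Game → Game

leftOpts : Game → List Game
leftOpts (node Ls _) = Ls

rightOpts : Game → List Game
rightOpts (node _ Rs) = Rs

𝟎 : Game
𝟎 = node [] []

mutual
  infixl 6 _⊕_
  _⊕_ : Game → Game → Game
  a@(node Ls Rs) ⊕ b@(node Ls' Rs') =
    node (mapˡ Ls b ++ mapʳ a Ls') (mapˡ Rs b ++ mapʳ a Rs')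

  mapˡ : List Game → Game → List Game
  mapˡ [] b = []
  mapˡ (x ∷ xs) b = (x ⊕ b) ∷ mapˡ xs b

  mapʳ : Game → List Game → List Game
  mapʳ a [] = []
  mapʳ a (y ∷ ys) = (a ⊕ y) ∷ mapʳ a ys

data AllSmall : Game → Set where
  allSmall : ∀ {Ls Rs} → (Ls ≡ [] ⇔ Rs ≡ []) →
             All AllSmall Ls → All AllSmall Rs → AllSmall (node Ls Rs)

data Binary : Game → Set where
  binary : ∀ {Ls Rs} → length Ls ≤ 1 → length Rs ≤ 1 →
           All Binary Ls → All Binary Rs → Binary (node Ls Rs)

data Player : Set where
  Left Right : Player

data AltPath : Player → Game → ℕ → Set where
  stop  : ∀ {p g} → AltPath p g 0
  stepL : ∀ {g g' k} → g' ∈ leftOpts g → AltPath Right g' k → AltPath Left g (suc k)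
  stepR : ∀ {g g' k} → g' ∈ rightOpts g → AltPath Left g' k → AltPath Right g (suc k)

record Ab (n : ℕ) (g : Game) : Set where
  field
    small  : AllSmall g
    bin    : Binary g
    bound  : ∀ p k → AltPath p g k → k ≤ n

-- Misère play: a player unable to move on their turn wins.
mutual
  lFirst : Game → Bool
  lFirst (node [] _) = true
  lFirst (node (l ∷ ls) _) = anyLSecond (l ∷ ls)

  lSecond : Game → Bool
  lSecond g = not (rFirst g)

  rFirst : Game → Bool
  rFirst (node _ []) = true
  rFirst (node _ (r ∷ rs)) = anyRSecond (r ∷ rs)

  rSecond : Game → Bool
  rSecond g = not (lFirst g)

  anyLSecond : List Game → Bool
  anyLSecond [] = false
  anyLSecond (g ∷ gs) with rFirst g
  ... | true  = anyLSecond gs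
  ... | false = true

  anyRSecond : List Game → Bool
  anyRSecond [] = false
  anyRSecond (g ∷ gs) with lFirst g
  ... | true  = anyRSecond gs
  ... | false = true

data Outcome : Set where
  𝓛 𝓡 𝓝 𝓟 : Outcome

outcome⁻ : Game → Outcome
outcome⁻ g with lFirst g | rFirst g
... | true  | false = 𝓛
... | false | true  = 𝓡
... | true  | true  = 𝓝
... | false | false = 𝓟

data ClAb3 : Game → Set where
  base : ∀ {g} → Ab 3 g → ClAb3 g
  sum  : ∀ {a b} → ClAb3 a → ClAb3 b → ClAb3 (a ⊕ b)
  optL : ∀ {g g'} → ClAb3 g → g' ∈ leftOpts g → ClAb3 g'
  optR : ∀ {g g'} → ClAb3 g → g' ∈ rightOpts g → ClAb3 g'

_≡[mod_]_ : Game → (Game → Set) → Game → Set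
α ≡[mod Γ ] β = ∀ γ → Γ γ → outcome⁻ (α ⊕ γ) ≡ outcome⁻ (β ⊕ γ)

module Submission where

-- Write ξ = {ξᴸ | ξᴿ} with ξᴸ = {A | 0} and ξᴿ = {0 | B}.  We show the
-- stronger fact that ξ ≡ 0 modulo ALL all-small positions.  Let γ be all-small.  If γ = 0, direct evaluation shows that ξ and 0 have the
-- same misère outcome.  Otherwise both players can move in γ, and in ξ + γ the move of
-- Left to ξᴸ + γ is never better for Left than her moves in γ: Right answers it by
-- moving to 0 + γ = γ, which wins for Right whenever Left, moving first in γ, loses.
-- Symmetrically for Right.  Every other move in ξ + γ is to ξ + γ' for an option γ' of γ,
-- and by induction ξ + γ' has the same outcomes as γ'.  Hence ξ + γ and γ have the same
-- outcomes, both with Left and with Right moving first.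

open import Defs
open import Data.Bool using (Bool; true; false; not; _∨_)
open import Data.List using (List; []; _∷_; _++_)
open import Data.List.Relation.Unary.All using (All; []; _∷_)
import Data.List.Relation.Unary.All as All
open import Data.List.Relation.Unary.All.Properties using (++⁺)
open import Function.Bundles using (_⇔_; mk⇔; Equivalence)
open import Relation.Binary.PropositionalEquality
  using (_≡_; refl; sym; cong; cong₂; module ≡-Reasoning)

mutual
  𝟎⊕ : ∀ g → 𝟎 ⊕ g ≡ g
  𝟎⊕ (node Ls Rs) = cong₂ node (mapʳ-𝟎 Ls) (mapʳ-𝟎 Rs)

  mapʳ-𝟎 : ∀ gs → mapʳ 𝟎 gs ≡ gs
  mapʳ-𝟎 []       = refl
  mapʳ-𝟎 (g ∷ gs) = cong₂ _∷_ (𝟎⊕ g) (mapʳ-𝟎 gs)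

sum-shape : ∀ Ls Rs Ls' Rs' → (Ls ≡ [] ⇔ Rs ≡ []) → (Ls' ≡ [] ⇔ Rs' ≡ []) →
  (mapˡ Ls (node Ls' Rs') ++ mapʳ (node Ls Rs) Ls' ≡ [] ⇔
   mapˡ Rs (node Ls' Rs') ++ mapʳ (node Ls Rs) Rs' ≡ [])
sum-shape (_ ∷ _) (_ ∷ _) _ _ _ _ = mk⇔ (λ ()) (λ ())
sum-shape [] (_ ∷ _) _ _ i _ with () ← Equivalence.to i refl
sum-shape (_ ∷ _) [] _ _ i _ with () ← Equivalence.from i refl
sum-shape [] [] [] [] _ _ = mk⇔ (λ _ → refl) (λ _ → refl)
sum-shape [] [] [] (_ ∷ _) _ i' with () ← Equivalence.to i' refl
sum-shape [] [] (_ ∷ _) [] _ i' with () ← Equivalence.from i' refl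
sum-shape [] [] (_ ∷ _) (_ ∷ _) _ _ = mk⇔ (λ ()) (λ ())

mutual
  AllSmall-⊕ : ∀ {a b} → AllSmall a → AllSmall b → AllSmall (a ⊕ b)
  AllSmall-⊕ sa@(allSmall {Ls} {Rs} i aL aR) sb@(allSmall {Ls'} {Rs'} i' bL bR) =
    allSmall (sum-shape Ls Rs Ls' Rs' i i')
      (++⁺ (AllSmall-mapˡ aL sb) (AllSmall-mapʳ sa bL))
      (++⁺ (AllSmall-mapˡ aR sb) (AllSmall-mapʳ sa bR))

  AllSmall-mapˡ : ∀ {as b} → All AllSmall as → AllSmall b → All AllSmall (mapˡ as b)
  AllSmall-mapˡ []       sb = []
  AllSmall-mapˡ (s ∷ ss) sb = AllSmall-⊕ s sb ∷ AllSmall-mapˡ ss sb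

  AllSmall-mapʳ : ∀ {a bs} → AllSmall a → All AllSmall bs → All AllSmall (mapʳ a bs)
  AllSmall-mapʳ sa []       = []
  AllSmall-mapʳ sa (s ∷ ss) = AllSmall-⊕ sa s ∷ AllSmall-mapʳ sa ss

ClAb3⇒AllSmall : ∀ {g} → ClAb3 g → AllSmall g
ClAb3⇒AllSmall (base ab) = Ab.small ab
ClAb3⇒AllSmall (sum c d) = AllSmall-⊕ (ClAb3⇒AllSmall c) (ClAb3⇒AllSmall d)
ClAb3⇒AllSmall (optL c m) with allSmall _ aL _ ← ClAb3⇒AllSmall c = All.lookup aL m
ClAb3⇒AllSmall (optR c m) with allSmall _ _ aR ← ClAb3⇒AllSmall c = All.lookup aR m

≡mod-restrict : ∀ {Γ Δ : Game → Set} {α β} → (∀ {γ} → Γ γ → Δ γ) →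
  α ≡[mod Δ ] β → α ≡[mod Γ ] β
≡mod-restrict Γ⊆Δ α≡β γ γ∈Γ = α≡β γ (Γ⊆Δ γ∈Γ)

anyLSecond-∷ : ∀ g gs → anyLSecond (g ∷ gs) ≡ not (rFirst g) ∨ anyLSecond gs
anyLSecond-∷ g gs with rFirst g
... | true  = refl
... | false = refl

anyRSecond-∷ : ∀ g gs → anyRSecond (g ∷ gs) ≡ not (lFirst g) ∨ anyRSecond gs
anyRSecond-∷ g gs with lFirst g
... | true  = refl
... | false = refl

outcomeOf : Bool → Bool → Outcome
outcomeOf true  false = 𝓛
outcomeOf false true  = 𝓡
outcomeOf true  true  = 𝓝
outcomeOf false false = 𝓟

outcome⁻-bits : ∀ g → outcome⁻ g ≡ outcomeOf (lFirst g) (rFirst g)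
outcome⁻-bits g with lFirst g | rFirst g
... | true  | false = refl
... | false | true  = refl
... | true  | true  = refl
... | false | false = refl

outcome⁻-cong : ∀ {a b} → lFirst a ≡ lFirst b → rFirst a ≡ rFirst b →
  outcome⁻ a ≡ outcome⁻ b
outcome⁻-cong {a} {b} l≡ r≡ = begin
  outcome⁻ a                      ≡⟨ outcome⁻-bits a ⟩
  outcomeOf (lFirst a) (rFirst a) ≡⟨ cong₂ outcomeOf l≡ r≡ ⟩
  outcomeOf (lFirst b) (rFirst b) ≡⟨ sym (outcome⁻-bits b) ⟩
  outcome⁻ b                      ∎
  where open ≡-Reasoning

-- The Boolean core of the argument: a move that the opponent can answer with a win
-- whenever b fails adds nothing to b.
absorb : ∀ b c → not (not b ∨ c) ∨ b ≡ b
absorb true  true  = refl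
absorb true  false = refl
absorb false _ = refl

module ReversibleThroughZero (A B : List Game) where
  ξᴸ ξᴿ ξ : Game
  ξᴸ = node A (𝟎 ∷ [])
  ξᴿ = node (𝟎 ∷ []) B
  ξ  = node (ξᴸ ∷ []) (ξᴿ ∷ [])

  -- In ξᴸ + γ, Right may move to 0 + γ = γ and then Left moves first in γ.
  rFirst-ξᴸ⊕ : ∀ γ → rFirst (ξᴸ ⊕ γ) ≡ not (lFirst γ) ∨ anyRSecond (mapʳ ξᴸ (rightOpts γ))
  rFirst-ξᴸ⊕ γ@(node _ Rs) = begin
    rFirst (ξᴸ ⊕ γ)                                      ≡⟨ anyRSecond-∷ (𝟎 ⊕ γ) _ ⟩
    not (lFirst (𝟎 ⊕ γ)) ∨ anyRSecond (mapʳ ξᴸ Rs)       ≡⟨ cong (λ g → not (lFirst g) ∨ anyRSecond (mapʳ ξᴸ Rs)) (𝟎⊕ γ) ⟩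
    not (lFirst γ) ∨ anyRSecond (mapʳ ξᴸ Rs)             ∎
    where open ≡-Reasoning

  lFirst-ξᴿ⊕ : ∀ γ → lFirst (ξᴿ ⊕ γ) ≡ not (rFirst γ) ∨ anyLSecond (mapʳ ξᴿ (leftOpts γ))
  lFirst-ξᴿ⊕ γ@(node Ls _) = begin
    lFirst (ξᴿ ⊕ γ)                                      ≡⟨ anyLSecond-∷ (𝟎 ⊕ γ) _ ⟩
    not (rFirst (𝟎 ⊕ γ)) ∨ anyLSecond (mapʳ ξᴿ Ls)       ≡⟨ cong (λ g → not (rFirst g) ∨ anyLSecond (mapʳ ξᴿ Ls)) (𝟎⊕ γ) ⟩
    not (rFirst γ) ∨ anyLSecond (mapʳ ξᴿ Ls)             ∎
    where open ≡-Reasoning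

  mutual
    lFirst-ξ⊕ : ∀ {γ} → AllSmall γ → lFirst (ξ ⊕ γ) ≡ lFirst γ
    lFirst-ξ⊕ (allSmall {[]} {[]} _ _ _) = refl
    lFirst-ξ⊕ (allSmall {[]} {_ ∷ _} i _ _) with () ← Equivalence.to i refl
    lFirst-ξ⊕ {γ} (allSmall {L@(_ ∷ _)} _ sL _) = begin
      lFirst (ξ ⊕ γ)                                                 ≡⟨ anyLSecond-∷ (ξᴸ ⊕ γ) _ ⟩
      not (rFirst (ξᴸ ⊕ γ)) ∨ anyLSecond (mapʳ ξ L)                  ≡⟨ cong₂ (λ r l → not r ∨ l) (rFirst-ξᴸ⊕ γ) (anyLSecond-ξ⊕ sL) ⟩
      not (not (lFirst γ) ∨ anyRSecond (mapʳ ξᴸ (rightOpts γ))) ∨ lFirst γ ≡⟨ absorb (lFirst γ) _ ⟩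
      lFirst γ                                                       ∎
      where open ≡-Reasoning

    rFirst-ξ⊕ : ∀ {γ} → AllSmall γ → rFirst (ξ ⊕ γ) ≡ rFirst γ
    rFirst-ξ⊕ (allSmall {[]} {[]} _ _ _) = refl
    rFirst-ξ⊕ (allSmall {_ ∷ _} {[]} i _ _) with () ← Equivalence.from i refl
    rFirst-ξ⊕ {γ} (allSmall {_} {R@(_ ∷ _)} _ _ sR) = begin
      rFirst (ξ ⊕ γ)                                                 ≡⟨ anyRSecond-∷ (ξᴿ ⊕ γ) _ ⟩
      not (lFirst (ξᴿ ⊕ γ)) ∨ anyRSecond (mapʳ ξ R)                  ≡⟨ cong₂ (λ l r → not l ∨ r) (lFirst-ξᴿ⊕ γ) (anyRSecond-ξ⊕ sR) ⟩
      not (not (rFirst γ) ∨ anyLSecond (mapʳ ξᴿ (leftOpts γ))) ∨ rFirst γ ≡⟨ absorb (rFirst γ) _ ⟩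
      rFirst γ                                                       ∎
      where open ≡-Reasoning

    anyLSecond-ξ⊕ : ∀ {gs} → All AllSmall gs → anyLSecond (mapʳ ξ gs) ≡ anyLSecond gs
    anyLSecond-ξ⊕ [] = refl
    anyLSecond-ξ⊕ {g ∷ gs} (s ∷ ss) = begin
      anyLSecond (mapʳ ξ (g ∷ gs))                   ≡⟨ anyLSecond-∷ (ξ ⊕ g) _ ⟩
      not (rFirst (ξ ⊕ g)) ∨ anyLSecond (mapʳ ξ gs)  ≡⟨ cong₂ (λ r l → not r ∨ l) (rFirst-ξ⊕ s) (anyLSecond-ξ⊕ ss) ⟩
      not (rFirst g) ∨ anyLSecond gs                 ≡⟨ sym (anyLSecond-∷ g gs) ⟩
      anyLSecond (g ∷ gs)                            ∎
      where open ≡-Reasoning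

    anyRSecond-ξ⊕ : ∀ {gs} → All AllSmall gs → anyRSecond (mapʳ ξ gs) ≡ anyRSecond gs
    anyRSecond-ξ⊕ [] = refl
    anyRSecond-ξ⊕ {g ∷ gs} (s ∷ ss) = begin
      anyRSecond (mapʳ ξ (g ∷ gs))                   ≡⟨ anyRSecond-∷ (ξ ⊕ g) _ ⟩
      not (lFirst (ξ ⊕ g)) ∨ anyRSecond (mapʳ ξ gs)  ≡⟨ cong₂ (λ l r → not l ∨ r) (lFirst-ξ⊕ s) (anyRSecond-ξ⊕ ss) ⟩
      not (lFirst g) ∨ anyRSecond gs                 ≡⟨ sym (anyRSecond-∷ g gs) ⟩
      anyRSecond (g ∷ gs)                            ∎
      where open ≡-Reasoning

  ξ≡𝟎 : ξ ≡[mod AllSmall ] 𝟎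
  ξ≡𝟎 γ s = begin
    outcome⁻ (ξ ⊕ γ) ≡⟨ outcome⁻-cong {ξ ⊕ γ} {γ} (lFirst-ξ⊕ s) (rFirst-ξ⊕ s) ⟩
    outcome⁻ γ       ≡⟨ cong outcome⁻ (sym (𝟎⊕ γ)) ⟩
    outcome⁻ (𝟎 ⊕ γ) ∎
    where open ≡-Reasoning

proposition5p2p11 : (ξ ξᴸ ξᴿ : Game) → Ab 3 ξ →
    leftOpts ξ ≡ ξᴸ ∷ [] → rightOpts ξ ≡ ξᴿ ∷ [] →
    rightOpts ξᴸ ≡ 𝟎 ∷ [] → leftOpts ξᴿ ≡ 𝟎 ∷ [] →
    ξ ≡[mod ClAb3 ] 𝟎
proposition5p2p11 (node _ _) (node A _) (node _ B) _ refl refl refl refl =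
  ≡mod-restrict {α = ReversibleThroughZero.ξ A B} {β = 𝟎} ClAb3⇒AllSmall
    (ReversibleThroughZero.ξ≡𝟎 A B)
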